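{- The set $K_{\mathsf{DTS}} = \{v \geq 3 : \text{there exists a DTS}(v)\text{ having a } v\text{ -good sequencing}\}$ is PBD-closed; that is, whenever there exists a $(v, K_{\mathsf{DTS}})$-PBD, we have $v \in K_{\mathsf{DTS}}$.
   Context: A transitive triple is an ordered triple $(x,y,z)$ of distinct elements; it contains the directed edges $(x,y)$, $(x,z)$, $(y,z)$. A directed triple system of order $v$, DTS$(v)$, is a pair $(X,\mathcal{B})$ where $X$ is a set of $v$ points and $\mathcal{B}$ is a set of transitive triples of elements of $X$ such that every ordered pair $(a,b)$ of distinct points of $X$ occurs as a directed edge in exactly one triple of $\mathcal{B}$. A $v$-good sequencing of a DTS$(v)$ $(X,\mathcal{B})$ is a permutation $[x_1\, x_2\, \cdots\, x_v]$ of $X$ such that for no triple $(x,y,z)\in\mathcal{B}$ do we have $x=x_i$, $y=x_j$, $z=x_k$ with $i<j<k$. For a set $K$ of integers $\geq 2$, a $(v,K)$-PBD (pairwise balanced design) is a pair $(X,\mathcal{B})$ with $|X|=v$ and $\mathcal{B}$ a set of subsets (blocks) of $X$ such that every pair of distinct points lies in exactly one block and $|B|\in K$ for every $B\in\mathcal{B}$. $K$ is PBD-closed if $v\in K$ whenever a $(v,K)$-PBD exists. -}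

module Defs where

open import Level using (0ℓ)
open import Data.Nat using (ℕ; _≥_)
open import Data.Fin using (Fin; _<_)
open import Data.Product using (_×_; Σ; ∃; _,_)
open import Data.Sum using (_⊎_)
open import Data.List using (List; length; lookup)
open import Data.List.Membership.Propositional using (_∈_)
open import Data.List.Relation.Unary.Unique.Propositional using (Unique)
open import Relation.Binary.PropositionalEquality using (_≡_)
open import Relation.Nullary using (¬_)
open import Function.Definitions using (Injective)

-- Transitive triple (x , y , z) on the point set Fin v, with distinct entries.
Triple : ℕ → Set
Triple v = Fin v × Fin v × Fin v

DistinctTriple : ∀ {v} → Triple v → Set
DistinctTriple (x , y , z) = ¬ x ≡ y × ¬ x ≡ z × ¬ y ≡ z

HasEdge : ∀ {v} → Triple v → Fin v → Fin v → Set
HasEdge (x , y , z) a b = (a ≡ x × b ≡ y) ⊎ (a ≡ x × b ≡ z) ⊎ (a ≡ y × b ≡ z)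

ExactlyOne : {A : Set} → (A → Set) → List A → Set
ExactlyOne P L = Σ (Fin (length L)) λ i → P (lookup L i) × (∀ j → P (lookup L j) → j ≡ i)

-- DTS(v) on point set Fin v: a collection of transitive triples such that every
-- ordered pair of distinct points is an edge of exactly one triple.
-- (Exactly-one counting by position also forces the list to have no repeats.)
record DTS (v : ℕ) : Set where
  field
    blocks   : List (Triple v)
    distinct : ∀ {t} → t ∈ blocks → DistinctTriple t
    balanced : ∀ (a b : Fin v) → ¬ a ≡ b → ExactlyOne (λ t → HasEdge t a b) blocks

-- A v-good sequencing [x_1 ... x_v]: given by the position map pos : Fin v → Fin v
-- (pos x = i iff x = x_i), a bijection of Fin v (injective suffices on a finite set;
-- we state it as injective).
GoodSequencing : ∀ {v} → DTS v → Set
GoodSequencing {v} D =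
  Σ (Fin v → Fin v) λ pos → Injective _≡_ _≡_ pos ×
    (∀ {x y z} → (x , y , z) ∈ DTS.blocks D → ¬ (pos x < pos y × pos y < pos z))

K-DTS : ℕ → Set
K-DTS v = v ≥ 3 × Σ (DTS v) GoodSequencing

record PBD (v : ℕ) (K : ℕ → Set) : Set where
  field
    blocks  : List (List (Fin v))
    setlike : ∀ {B} → B ∈ blocks → Unique B
    sizes   : ∀ {B} → B ∈ blocks → K (length B)
    pairs   : ∀ (a b : Fin v) → ¬ a ≡ b → ExactlyOne (λ B → a ∈ B × b ∈ B) blocks

-- K is PBD-closed.  Trivial designs on 0 or 1 point (empty block set) are excluded,
-- as is standard (otherwise no K ⊆ {k ≥ 2} could be PBD-closed).
PBDClosed : (ℕ → Set) → Set
PBDClosed K = ∀ v → v ≥ 2 → PBD v K → K v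

-- Sort each block B of the PBD increasingly and copy onto it a DTS(|B|) together with its good
-- sequencing, so that the k-th point of the sequencing lands on the k-th smallest point of B.
-- Every block then carries a DTS for which the natural order of the points is a good
-- sequencing; since every pair of points lies in exactly one block, the union of these triple
-- systems is a DTS(v), and the natural order of the points is a v-good sequencing of it.
module Submission where

open import Defs
open import Data.Nat as ℕ using (ℕ; _≤_; _≥_; s≤s)
import Data.Nat.Properties as ℕₚ
open import Data.Fin using (Fin; zero; suc; _<_; punchOut)
open import Data.Fin.Properties as Fin
  using (<-cmp; <-irrefl; <-asym; <⇒≢; ≤∧≢⇒<; 0≢1+n; suc-injective; any?; _≟_;
         punchOut-injective; injective⇒≤)
open import Data.Product using (Σ; ∃; _×_; _,_; proj₁; proj₂)
open import Data.Sum using (inj₁; inj₂)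
open import Data.Empty using (⊥-elim)
open import Data.List using (List; []; _∷_; length; lookup; _++_; map)
open import Data.List.Relation.Unary.All as All using (All; []; _∷_)
import Data.List.Relation.Unary.All.Properties as All
open import Data.List.Relation.Unary.Any using (index)
open import Data.List.Relation.Unary.Any.Properties using (lookup-index)
open import Data.List.Relation.Unary.AllPairs using (AllPairs; _∷_)
open import Data.List.Relation.Unary.Unique.Propositional using (Unique)
open import Data.List.Relation.Unary.Sorted.TotalOrder.Properties using (lookup-mono-≤)
open import Data.List.Membership.Propositional using (_∈_)
open import Data.List.Membership.Propositional.Properties using (∈-lookup)
open import Data.List.Relation.Binary.Permutation.Propositional using (↭-sym; ↭⇒↭ₛ)
open import Data.List.Relation.Binary.Permutation.Propositional.Properties using (↭-length; ∈-resp-↭)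
open import Data.List.Relation.Binary.Permutation.Setoid.Properties using (Unique-resp-↭)
open import Relation.Binary.Core using (_Preserves_⟶_)
open import Relation.Binary.Definitions using (tri<; tri≈; tri>)
open import Relation.Binary.PropositionalEquality
open import Relation.Nullary using (¬_; yes; no)
open import Function using (_∘_)
open import Function.Definitions using (Injective; Surjective)

data One {A : Set} (P : A → Set) : List A → Set where
  hit  : ∀ {x xs} → P x → All (¬_ ∘ P) xs → One P (x ∷ xs)
  miss : ∀ {x xs} → ¬ P x → One P xs → One P (x ∷ xs)

module _ {A : Set} {P : A → Set} where

  ExactlyOne⇒One : ∀ xs → ExactlyOne P xs → One P xs
  ExactlyOne⇒One (x ∷ xs) (zero , px , unique) =
    hit px (All.tabulate λ y∈xs py →
      0≢1+n (sym (unique (suc (index y∈xs)) (subst P (lookup-index y∈xs) py))))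
  ExactlyOne⇒One (x ∷ xs) (suc i , pi , unique) =
    miss (λ px → 0≢1+n (unique zero px))
         (ExactlyOne⇒One xs (i , pi , λ j pj → suc-injective (unique (suc j) pj)))

  One⇒ExactlyOne : ∀ {xs} → One P xs → ExactlyOne P xs
  One⇒ExactlyOne (hit px others) =
    zero , px , λ { zero _ → refl ; (suc j) pj → ⊥-elim (All.lookup others (∈-lookup j) pj) }
  One⇒ExactlyOne (miss ¬px rest) with i , pi , unique ← One⇒ExactlyOne rest =
    suc i , pi , λ { zero px → ⊥-elim (¬px px) ; (suc j) pj → cong suc (unique j pj) }

  One-++⁺ˡ : ∀ {xs ys} → One P xs → All (¬_ ∘ P) ys → One P (xs ++ ys)
  One-++⁺ˡ (hit px others) none = hit px (All.++⁺ others none)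
  One-++⁺ˡ (miss ¬px rest) none = miss ¬px (One-++⁺ˡ rest none)

  One-++⁺ʳ : ∀ {xs ys} → All (¬_ ∘ P) xs → One P ys → One P (xs ++ ys)
  One-++⁺ʳ []            one = one
  One-++⁺ʳ (¬px ∷ none) one = miss ¬px (One-++⁺ʳ none one)

One-map⁺ : ∀ {A B : Set} {P : A → Set} {Q : B → Set} (f : A → B) →
           (∀ {x} → P x → Q (f x)) → (∀ {x} → Q (f x) → P x) →
           ∀ {xs} → One P xs → One Q (map f xs)
One-map⁺ f to from (hit px others) = hit (to px) (All.map⁺ (All.map (_∘ from) others))
One-map⁺ f to from (miss ¬px rest) = miss (¬px ∘ from) (One-map⁺ f to from rest)

AllPairs-lookup : ∀ {A : Set} {R : A → A → Set} {xs : List A} → AllPairs R xs →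
                  ∀ {i j} → i < j → R (lookup xs i) (lookup xs j)
AllPairs-lookup (rs ∷ _)   {zero}  {suc j} _         = All.lookup rs (∈-lookup j)
AllPairs-lookup (_ ∷ rss) {suc i} {suc j} (s≤s i<j) = AllPairs-lookup rss i<j

lookup-injective : ∀ {A : Set} {xs : List A} → Unique xs → Injective _≡_ _≡_ (lookup xs)
lookup-injective xs-unique {i} {j} eq with <-cmp i j
... | tri< i<j _ _ = ⊥-elim (AllPairs-lookup xs-unique i<j eq)
... | tri≈ _ i≡j _ = i≡j
... | tri> _ _ j<i = ⊥-elim (AllPairs-lookup xs-unique j<i (sym eq))

Unique⇒length≤ : ∀ {n} {xs : List (Fin n)} → Unique xs → length xs ≤ n
Unique⇒length≤ xs-unique = injective⇒≤ (lookup-injective xs-unique)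

injective⇒surjective : ∀ {n} {f : Fin n → Fin n} → Injective _≡_ _≡_ f → Surjective _≡_ _≡_ f
injective⇒surjective {ℕ.suc n} {f} f-injective y with any? (λ x → f x ≟ y)
... | yes (x , fx≡y) = x , λ { refl → fx≡y }
... | no ¬hit = ⊥-elim (ℕₚ.<-irrefl refl (injective⇒≤ punchOut∘f-injective))
  where
  -- If y were missed, punching it out would inject Fin (suc n) into Fin n.
  f≢y : ∀ x → y ≢ f x
  f≢y x eq = ¬hit (x , sym eq)
  punchOut∘f-injective : Injective _≡_ _≡_ (λ x → punchOut (f≢y x))
  punchOut∘f-injective eq = f-injective (punchOut-injective (f≢y _) (f≢y _) eq)

module _ {m n} {f : Fin m → Fin n} (f-mono : f Preserves _<_ ⟶ _<_) where

  strictMono⇒injective : Injective _≡_ _≡_ f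
  strictMono⇒injective {i} {j} eq with <-cmp i j
  ... | tri< i<j _ _ = ⊥-elim (<⇒≢ (f-mono i<j) eq)
  ... | tri≈ _ i≡j _ = i≡j
  ... | tri> _ _ j<i = ⊥-elim (<⇒≢ (f-mono j<i) (sym eq))

  strictMono-reflects : ∀ {i j} → f i < f j → i < j
  strictMono-reflects {i} {j} fi<fj with <-cmp i j
  ... | tri< i<j _ _  = i<j
  ... | tri≈ _ refl _ = ⊥-elim (<-irrefl refl fi<fj)
  ... | tri> _ _ j<i  = ⊥-elim (<-asym fi<fj (f-mono j<i))

mapTriple : ∀ {k v} → (Fin k → Fin v) → Triple k → Triple v
mapTriple f (x , y , z) = f x , f y , f z

Edge : ∀ {v} → Fin v → Fin v → Triple v → Set
Edge a b t = HasEdge t a b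

Increasing : ∀ {v} → Triple v → Set
Increasing (x , y , z) = x < y × y < z

module _ {k v} {f : Fin k → Fin v} where

  DistinctTriple-map : Injective _≡_ _≡_ f → ∀ {t} → DistinctTriple t → DistinctTriple (mapTriple f t)
  DistinctTriple-map f-inj (x≢y , x≢z , y≢z) = x≢y ∘ f-inj , x≢z ∘ f-inj , y≢z ∘ f-inj

  Edge-map⁺ : ∀ {a b} t → Edge a b t → Edge (f a) (f b) (mapTriple f t)
  Edge-map⁺ _ (inj₁ (refl , refl))        = inj₁ (refl , refl)
  Edge-map⁺ _ (inj₂ (inj₁ (refl , refl))) = inj₂ (inj₁ (refl , refl))
  Edge-map⁺ _ (inj₂ (inj₂ (refl , refl))) = inj₂ (inj₂ (refl , refl))

  Edge-map⁻ : Injective _≡_ _≡_ f → ∀ {a b} t → Edge (f a) (f b) (mapTriple f t) → Edge a b t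
  Edge-map⁻ f-inj _ (inj₁ (p , q))        = inj₁ (f-inj p , f-inj q)
  Edge-map⁻ f-inj _ (inj₂ (inj₁ (p , q))) = inj₂ (inj₁ (f-inj p , f-inj q))
  Edge-map⁻ f-inj _ (inj₂ (inj₂ (p , q))) = inj₂ (inj₂ (f-inj p , f-inj q))

  Edge-map-endpoints : ∀ {P : Fin v → Set} → (∀ i → P (f i)) →
                       ∀ {a b} t → Edge a b (mapTriple f t) → P a × P b
  Edge-map-endpoints into (x , y , z) (inj₁ (refl , refl))        = into x , into y
  Edge-map-endpoints into (x , y , z) (inj₂ (inj₁ (refl , refl))) = into x , into z
  Edge-map-endpoints into (x , y , z) (inj₂ (inj₂ (refl , refl))) = into y , into z

record GoodDTSOn {v} (P : Fin v → Set) (T : List (Triple v)) : Set where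
  field
    distinct    : All DistinctTriple T
    unsequenced : All (¬_ ∘ Increasing) T
    inside      : ∀ {a b} → P a → P b → a ≢ b → One (Edge a b) T
    outside     : ∀ {a b} → ¬ (P a × P b) → All (¬_ ∘ Edge a b) T

embedDTS : ∀ {k v} {P : Fin v → Set} (D : DTS k) → GoodSequencing D →
           (g : Fin k → Fin v) → g Preserves _<_ ⟶ _<_ →
           (∀ i → P (g i)) → (∀ {a} → P a → ∃ λ i → g i ≡ a) → ∃ (GoodDTSOn P)
embedDTS {k} {v} {P} D (pos , pos-injective , pos-good) g g-mono g-into g-onto =
  map (mapTriple h) blocks , record
    { distinct    = All.map⁺ (All.tabulate (DistinctTriple-map h-injective ∘ DTS.distinct D))
    ; unsequenced = All.map⁺ (All.tabulate λ t∈ → unsequenced (pos-good t∈))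
    ; inside      = inside
    ; outside     = λ ¬PaPb → All.map⁺ (All.tabulate λ {t} _ → ¬PaPb ∘ Edge-map-endpoints h-into t)
    }
  where
  open DTS D using (blocks)
  h : Fin k → Fin v
  h = g ∘ pos
  h-injective : Injective _≡_ _≡_ h
  h-injective = pos-injective ∘ strictMono⇒injective g-mono
  h-into : ∀ p → P (h p)
  h-into = g-into ∘ pos

  unsequenced : ∀ {x y z} → ¬ Increasing (mapTriple pos (x , y , z)) → ¬ Increasing (mapTriple h (x , y , z))
  unsequenced ¬inc (hx<hy , hy<hz) = ¬inc (strictMono-reflects g-mono hx<hy , strictMono-reflects g-mono hy<hz)

  h-onto : ∀ {a} → P a → ∃ λ p → h p ≡ a
  h-onto Pa with i , gi≡a ← g-onto Pa with p , pos-p≡i ← injective⇒surjective pos-injective i =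
    p , trans (cong g (pos-p≡i refl)) gi≡a

  inside : ∀ {a b} → P a → P b → a ≢ b → One (Edge a b) (map (mapTriple h) blocks)
  inside Pa Pb a≢b with p , refl ← h-onto Pa | q , refl ← h-onto Pb =
    One-map⁺ (mapTriple h) (Edge-map⁺ _) (Edge-map⁻ h-injective _)
      (ExactlyOne⇒One blocks (DTS.balanced D p q (a≢b ∘ cong h)))

module _ {v : ℕ} where
  open import Data.List.Sort (Fin.≤-decTotalOrder v) using (sort; sort-↭; sort-↗)

  blockDTS : ∀ {B : List (Fin v)} → Unique B → K-DTS (length B) → ∃ (GoodDTSOn (_∈ B))
  blockDTS {B} B-unique (_ , Dσ) =
    embedDTS (proj₁ Dσ′) (proj₂ Dσ′) (lookup S) lookup-mono
      (∈-resp-↭ (sort-↭ B) ∘ ∈-lookup) S-onto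
    where
    S : List (Fin v)
    S = sort B
    Dσ′ : Σ (DTS (length S)) GoodSequencing
    Dσ′ = subst (λ n → Σ (DTS n) GoodSequencing) (sym (↭-length (sort-↭ B))) Dσ
    S-unique : Unique S
    S-unique = Unique-resp-↭ (setoid (Fin v)) (↭⇒↭ₛ (↭-sym (sort-↭ B))) B-unique
    lookup-mono : lookup S Preserves _<_ ⟶ _<_
    lookup-mono i<j = ≤∧≢⇒< (lookup-mono-≤ (Fin.≤-totalOrder v) (sort-↗ B) (ℕₚ.<⇒≤ i<j))
                            (<⇒≢ i<j ∘ lookup-injective S-unique)
    S-onto : ∀ {a} → a ∈ B → ∃ λ i → lookup S i ≡ a
    S-onto a∈B with a∈S ← ∈-resp-↭ (↭-sym (sort-↭ B)) a∈B = index a∈S , sym (lookup-index a∈S)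

BlockDTSs : ∀ {v} → List (List (Fin v)) → Set
BlockDTSs Bs = All (λ B → ∃ (GoodDTSOn (_∈ B))) Bs

unionTriples : ∀ {v} {Bs : List (List (Fin v))} → BlockDTSs Bs → List (Triple v)
unionTriples []             = []
unionTriples ((T , _) ∷ ds) = T ++ unionTriples ds

module _ {v : ℕ} where

  union-all : ∀ {Q : Triple v → Set} → (∀ {B T} → GoodDTSOn (_∈ B) T → All Q T) →
              ∀ {Bs : List (List (Fin v))} (ds : BlockDTSs Bs) → All Q (unionTriples ds)
  union-all each []             = []
  union-all each ((_ , d) ∷ ds) = All.++⁺ (each d) (union-all each ds)

  union-outside : ∀ {a b : Fin v} {Bs} (ds : BlockDTSs Bs) →
                  All (λ B → ¬ (a ∈ B × b ∈ B)) Bs → All (¬_ ∘ Edge a b) (unionTriples ds)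
  union-outside []             []               = []
  union-outside ((_ , d) ∷ ds) (¬ab∈B ∷ ¬ab∈Bs) =
    All.++⁺ (GoodDTSOn.outside d ¬ab∈B) (union-outside ds ¬ab∈Bs)

  union-edge : ∀ {a b : Fin v} {Bs} (ds : BlockDTSs Bs) → a ≢ b →
               One (λ B → a ∈ B × b ∈ B) Bs → One (Edge a b) (unionTriples ds)
  union-edge ((_ , d) ∷ ds) a≢b (hit (a∈B , b∈B) others) =
    One-++⁺ˡ (GoodDTSOn.inside d a∈B b∈B a≢b) (union-outside ds others)
  union-edge ((_ , d) ∷ ds) a≢b (miss ¬ab∈B rest) =
    One-++⁺ʳ (GoodDTSOn.outside d ¬ab∈B) (union-edge ds a≢b rest)

PBD-order≥ : ∀ {K : ℕ → Set} {m v} → (∀ {k} → K k → m ≤ k) → v ≥ 2 → PBD v K → m ≤ v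
PBD-order≥ {v = 1} _ (s≤s ()) _
PBD-order≥ {v = ℕ.suc (ℕ.suc _)} K≥m _ P
  with i , (zero∈B , _) , _ ← PBD.pairs P zero (suc zero) (λ ())
  = ℕₚ.≤-trans (K≥m (PBD.sizes P B∈)) (Unique⇒length≤ (PBD.setlike P B∈))
  where B∈ = ∈-lookup i

theorem2p1 : PBDClosed K-DTS
theorem2p1 v v≥2 P =
  PBD-order≥ proj₁ v≥2 P , D , (λ x → x) , (λ eq → eq) ,
  All.lookup (union-all GoodDTSOn.unsequenced blockDTSs)
  where
  open PBD P using (blocks; setlike; sizes; pairs)
  blockDTSs : BlockDTSs blocks
  blockDTSs = All.tabulate λ B∈ → blockDTS (setlike B∈) (sizes B∈)
  D : DTS v
  D = record
    { blocks   = unionTriples blockDTSs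
    ; distinct = All.lookup (union-all GoodDTSOn.distinct blockDTSs)
    ; balanced = λ a b a≢b →
        One⇒ExactlyOne (union-edge blockDTSs a≢b (ExactlyOne⇒One blocks (pairs a b a≢b)))
    }
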